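{- Let $T\subseteq X_0$ be a generalised nice set with $T\cap X=\emptyset$. Then either (a) there is $i\in I$ with $T=\{\{0,i\},\{i,i\},\{0,0\}\}$; or (b) $\{\{0,0\}\}\subseteq T\subseteq X_F$; or (c) $T\subseteq \{\{i,i\}:i\in I\}$. Moreover, every set $T\subseteq X_0\setminus X$ satisfying (a), (b) or (c) is a generalised nice set.
   Context: Let $I=\{1,\dots,7\}$ and $I_0=I\cup\{0\}$. The Fano plane on $I$ has the seven lines $\{1,2,5\},\{5,6,7\},\{1,4,7\},\{1,3,6\},\{2,4,6\},\{2,3,7\},\{3,4,5\}$. For distinct $i,j\in I$, $i*j$ is the third point of the unique line containing $i$ and $j$. The operation is extended to $I_0$ by $0*i=i*0=i$ and $i*i=0$ for all $i\in I_0$. Let $X_0$ be the set of unordered pairs $\{i,j\}$ with $i,j\in I_0$, where $i=j$ is allowed; $X=\{\{i,j\}:i,j\in I,\ i\neq j\}$ and $X_F=\{\{0,i\}:i\in I_0\}$. For $i,j,k\in I_0$ let $P_{\{i,j,k\}}=\{\{i,j\},\{j,k\},\{k,i\},\{i,j*k\},\{j,k*i\},\{k,i*j\}\}\subseteq X_0$. A subset $T\subseteq X_0$ is a generalised nice set if for all $i,j,k\in I_0$, $\{i,j\}\in T$ and $\{i*j,k\}\in T$ imply $P_{\{i,j,k\}}\subseteq T$. -}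

module Defs where

open import Data.Fin using (Fin; zero; #_)
open import Data.Vec using (Vec; []; _∷_; lookup)
open import Data.Bool using (Bool; true; false)
open import Data.Product using (_×_; Σ-syntax)
open import Data.Sum using (_⊎_)
open import Relation.Binary.PropositionalEquality using (_≡_; _≢_)
open import Function.Bundles using (_⇔_)

-- I₀ = {0,…,7}, with I = {1,…,7} the nonzero elements.
I₀ : Set
I₀ = Fin 8

-- Fano lines: {1,2,5},{5,6,7},{1,4,7},{1,3,6},{2,4,6},{2,3,7},{3,4,5};
-- for distinct i,j ∈ I, i * j is the third point of the line through i and j;
-- 0 * i = i * 0 = i and i * i = 0.
mulTable : Vec (Vec I₀ 8) 8
mulTable =
    (# 0 ∷ # 1 ∷ # 2 ∷ # 3 ∷ # 4 ∷ # 5 ∷ # 6 ∷ # 7 ∷ [])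
  ∷ (# 1 ∷ # 0 ∷ # 5 ∷ # 6 ∷ # 7 ∷ # 2 ∷ # 3 ∷ # 4 ∷ [])
  ∷ (# 2 ∷ # 5 ∷ # 0 ∷ # 7 ∷ # 6 ∷ # 1 ∷ # 4 ∷ # 3 ∷ [])
  ∷ (# 3 ∷ # 6 ∷ # 7 ∷ # 0 ∷ # 5 ∷ # 4 ∷ # 1 ∷ # 2 ∷ [])
  ∷ (# 4 ∷ # 7 ∷ # 6 ∷ # 5 ∷ # 0 ∷ # 3 ∷ # 2 ∷ # 1 ∷ [])
  ∷ (# 5 ∷ # 2 ∷ # 1 ∷ # 4 ∷ # 3 ∷ # 0 ∷ # 7 ∷ # 6 ∷ [])
  ∷ (# 6 ∷ # 3 ∷ # 4 ∷ # 1 ∷ # 2 ∷ # 7 ∷ # 0 ∷ # 5 ∷ [])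
  ∷ (# 7 ∷ # 4 ∷ # 3 ∷ # 2 ∷ # 1 ∷ # 6 ∷ # 5 ∷ # 0 ∷ [])
  ∷ []

_⋆_ : I₀ → I₀ → I₀
i ⋆ j = lookup (lookup mulTable i) j

-- A subset T ⊆ X₀ of unordered pairs {i,j} (i = j allowed) is represented by a
-- symmetric Bool-valued relation on I₀: {i,j} ∈ T  iff  T i j ≡ true.
Rel₀ : Set
Rel₀ = I₀ → I₀ → Bool

Symmetric : Rel₀ → Set
Symmetric T = ∀ a b → T a b ≡ T b a

SamePair : I₀ → I₀ → I₀ → I₀ → Set
SamePair a b c d = (a ≡ c × b ≡ d) ⊎ (a ≡ d × b ≡ c)

InP : I₀ → I₀ → I₀ → I₀ → I₀ → Set
InP i j k a b =
  SamePair a b i j ⊎ SamePair a b j k ⊎ SamePair a b k i ⊎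
  SamePair a b i (j ⋆ k) ⊎ SamePair a b j (k ⋆ i) ⊎ SamePair a b k (i ⋆ j)

GenNice : Rel₀ → Set
GenNice T = ∀ i j k → T i j ≡ true → T (i ⋆ j) k ≡ true →
            ∀ a b → InP i j k a b → T a b ≡ true

InX : I₀ → I₀ → Set
InX a b = a ≢ zero × b ≢ zero × a ≢ b

DisjointX : Rel₀ → Set
DisjointX T = ∀ a b → InX a b → T a b ≢ true

CondA : Rel₀ → Set
CondA T = Σ[ i ∈ I₀ ] (i ≢ zero ×
  (∀ a b → (T a b ≡ true) ⇔
     (SamePair a b zero i ⊎ SamePair a b i i ⊎ SamePair a b zero zero)))

CondB : Rel₀ → Set
CondB T = T zero zero ≡ true × (∀ a b → T a b ≡ true → (a ≡ zero ⊎ b ≡ zero))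

CondC : Rel₀ → Set
CondC T = ∀ a b → T a b ≡ true → (a ≡ b × a ≢ zero)

{-# OPTIONS --safe #-}
-- A pair outside X has the form {0,b} or {a,a}. For T avoiding X, niceness
-- amounts to three closure properties: {0,m} ∈ T forces {0,0} ∈ T; {m,m} and
-- {0,0} in T force {0,m} ∈ T; and {m,m}, {0,n} ∈ T with m, n ≠ 0 force m = n
-- (otherwise P_{m,m,n} would contain the pair {m,n} ∈ X). The three properties
-- then sort T by whether {0,0} ∈ T and whether some {i,i} with i ≠ 0 lies in T.
module Submission where

open import Defs
open import Data.Bool using (true)
import Data.Bool.Properties as Bool
open import Data.Empty using (⊥-elim)
open import Data.Fin using (zero; _≟_)
open import Data.Fin.Properties using (all?; any?)
open import Data.Product using (_×_; _,_; proj₂)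
open import Data.Sum using (_⊎_; inj₁; inj₂; reduce)
open import Function.Bundles using (mk⇔; Equivalence)
open import Relation.Binary.PropositionalEquality using (_≡_; _≢_; refl; sym; trans; subst)
open import Relation.Nullary using (yes; no)
open import Relation.Nullary.Decidable using (from-yes; ¬?; _×-dec_)

⋆-identityˡ : ∀ m → zero ⋆ m ≡ m
⋆-identityˡ = from-yes (all? λ m → zero ⋆ m ≟ m)

⋆-identityʳ : ∀ m → m ⋆ zero ≡ m
⋆-identityʳ = from-yes (all? λ m → m ⋆ zero ≟ m)

⋆-same : ∀ m → m ⋆ m ≡ zero
⋆-same = from-yes (all? λ m → m ⋆ m ≟ zero)

data OutsideX : I₀ → I₀ → Set where
  axisˡ    : ∀ b → OutsideX zero b
  axisʳ    : ∀ a → OutsideX a zero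
  diagonal : ∀ a → OutsideX a a

outsideX : ∀ a b → InX a b ⊎ OutsideX a b
outsideX a b with a ≟ zero | b ≟ zero | a ≟ b
... | yes refl | _        | _        = inj₂ (axisˡ b)
... | no _     | yes refl | _        = inj₂ (axisʳ a)
... | no _     | no _     | yes refl = inj₂ (diagonal a)
... | no a≢0   | no b≢0   | no a≢b   = inj₁ (a≢0 , b≢0 , a≢b)

∈P-jk : ∀ {i j k} → InP i j k j k
∈P-jk = inj₂ (inj₁ (inj₁ (refl , refl)))

∈P-ki : ∀ {i j k} → InP i j k k i
∈P-ki = inj₂ (inj₂ (inj₁ (inj₁ (refl , refl))))

InA : I₀ → I₀ → I₀ → Set
InA i a b = SamePair a b zero i ⊎ SamePair a b i i ⊎ SamePair a b zero zero

record ReducedNice (T : Rel₀) : Set where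
  field
    axis⇒origin          : ∀ m → T zero m ≡ true → T zero zero ≡ true
    diagonal⇒axis        : ∀ m → T m m ≡ true → T zero zero ≡ true → T zero m ≡ true
    diagonal-axis-unique : ∀ m n → m ≢ zero → n ≢ zero →
                           T m m ≡ true → T zero n ≡ true → m ≡ n

module _ {T : Rel₀} (S : Symmetric T) where

  ∈-sym : ∀ {a b} → T a b ≡ true → T b a ≡ true
  ∈-sym {a} {b} = trans (S b a)

  ∈-SamePair : ∀ {a b x y} → SamePair a b x y → T x y ≡ true → T a b ≡ true
  ∈-SamePair (inj₁ (refl , refl)) h = h
  ∈-SamePair (inj₂ (refl , refl)) h = ∈-sym h

  ∉X : DisjointX T → ∀ {a b} → T a b ≡ true → OutsideX a b
  ∉X D {a} {b} h with outsideX a b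
  ... | inj₁ a∈X = ⊥-elim (D a b a∈X h)
  ... | inj₂ o   = o

  P⊆T : ∀ {i j k jk ki ij} → j ⋆ k ≡ jk → k ⋆ i ≡ ki → i ⋆ j ≡ ij →
        T i j ≡ true → T j k ≡ true → T k i ≡ true →
        T i jk ≡ true → T j ki ≡ true → T k ij ≡ true →
        ∀ a b → InP i j k a b → T a b ≡ true
  P⊆T refl refl refl h₁ _  _  _  _  _  _ _ (inj₁ p)                               = ∈-SamePair p h₁
  P⊆T refl refl refl _  h₂ _  _  _  _  _ _ (inj₂ (inj₁ p))                        = ∈-SamePair p h₂
  P⊆T refl refl refl _  _  h₃ _  _  _  _ _ (inj₂ (inj₂ (inj₁ p)))                 = ∈-SamePair p h₃
  P⊆T refl refl refl _  _  _  h₄ _  _  _ _ (inj₂ (inj₂ (inj₂ (inj₁ p))))          = ∈-SamePair p h₄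
  P⊆T refl refl refl _  _  _  _  h₅ _  _ _ (inj₂ (inj₂ (inj₂ (inj₂ (inj₁ p)))))   = ∈-SamePair p h₅
  P⊆T refl refl refl _  _  _  _  _  h₆ _ _ (inj₂ (inj₂ (inj₂ (inj₂ (inj₂ p)))))   = ∈-SamePair p h₆

  ∈-congˡ : ∀ {x y b} → x ≡ y → T x b ≡ true → T y b ≡ true
  ∈-congˡ {b = b} = subst (λ x → T x b ≡ true)

  genNice⇒reducedNice : DisjointX T → GenNice T → ReducedNice T
  genNice⇒reducedNice D G = record
    { axis⇒origin          = λ m h →
        G zero m zero h (∈-congˡ (sym (⋆-identityˡ m)) (∈-sym h)) zero zero ∈P-ki
    ; diagonal⇒axis        = λ m h h00 →
        G m m zero h (∈-congˡ (sym (⋆-same m)) h00) zero m ∈P-ki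
    ; diagonal-axis-unique = unique
    }
    where
    unique : ∀ m n → m ≢ zero → n ≢ zero → T m m ≡ true → T zero n ≡ true → m ≡ n
    unique m n m≢0 n≢0 hmm h0n with m ≟ n
    ... | yes m≡n = m≡n
    ... | no m≢n  = ⊥-elim (D m n (m≢0 , n≢0 , m≢n)
                     (G m m n hmm (∈-congˡ (sym (⋆-same m)) h0n) m n ∈P-jk))

  module _ (D : DisjointX T) where

    condB : T zero zero ≡ true → (∀ m → m ≢ zero → T m m ≢ true) → CondB T
    condB h00 no-diagonal = h00 , axis
      where
      axis : ∀ a b → T a b ≡ true → a ≡ zero ⊎ b ≡ zero
      axis a b h with ∉X D h
      ... | axisˡ b    = inj₁ refl
      ... | axisʳ a    = inj₂ refl
      ... | diagonal a with a ≟ zero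
      ...   | yes a≡0 = inj₁ a≡0
      ...   | no a≢0  = ⊥-elim (no-diagonal a a≢0 h)

    module _ (R : ReducedNice T) where
      open ReducedNice R

      P⊆T-00m : ∀ m → T zero m ≡ true → ∀ a b → InP zero zero m a b → T a b ≡ true
      P⊆T-00m m h = P⊆T (⋆-identityˡ m) (⋆-identityʳ m) refl
                        (axis⇒origin m h) h (∈-sym h) h h (∈-sym h)

      nice-axisˡ : ∀ j k → T zero j ≡ true → T j k ≡ true → ∀ a b → InP zero j k a b → T a b ≡ true
      nice-axisˡ j k h0j hjk with ∉X D hjk
      ... | axisˡ k    = P⊆T-00m k hjk
      ... | axisʳ j    = P⊆T (⋆-identityʳ j) refl (⋆-identityˡ j)
                             h0j hjk (axis⇒origin j h0j) h0j hjk h0j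
      ... | diagonal j = P⊆T (⋆-same j) (⋆-identityʳ j) (⋆-identityˡ j)
                             h0j hjk (∈-sym h0j) (axis⇒origin j h0j) hjk hjk

      nice-axisʳ : ∀ i k → T i zero ≡ true → T i k ≡ true → ∀ a b → InP i zero k a b → T a b ≡ true
      nice-axisʳ i k hi0 hik with ∉X D hik
      ... | axisˡ k    = P⊆T-00m k hik
      ... | axisʳ i    = P⊆T refl (⋆-identityˡ i) (⋆-identityʳ i)
                             hi0 (axis⇒origin i (∈-sym hi0)) (∈-sym hi0) hi0 (∈-sym hi0) (∈-sym hi0)
      ... | diagonal i = P⊆T (⋆-identityˡ i) (⋆-same i) (⋆-identityʳ i)
                             hi0 (∈-sym hi0) hik hik (axis⇒origin i (∈-sym hi0)) hik

      nice-diagonal : ∀ i k → T i i ≡ true → T zero k ≡ true → ∀ a b → InP i i k a b → T a b ≡ true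
      nice-diagonal i k hii h0k with i ≟ zero | k ≟ zero
      ... | yes refl | _        = P⊆T-00m k h0k
      ... | no _     | yes refl = P⊆T (⋆-identityʳ i) (⋆-identityˡ i) (⋆-same i)
                                      hii (∈-sym h0i) h0i hii hii h0k
        where h0i = diagonal⇒axis i hii h0k
      ... | no i≢0   | no k≢0 with diagonal-axis-unique i k i≢0 k≢0 hii h0k
      ... | refl = P⊆T (⋆-same i) (⋆-same i) (⋆-same i) hii hii hii hi0 hi0 hi0
        where hi0 = ∈-sym h0k

      reducedNice⇒genNice : GenNice T
      reducedNice⇒genNice i j k hij hk with ∉X D hij
      ... | axisˡ j    = nice-axisˡ j k hij (∈-congˡ (⋆-identityˡ j) hk)
      ... | axisʳ i    = nice-axisʳ i k hij (∈-congˡ (⋆-identityʳ i) hk)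
      ... | diagonal i = nice-diagonal i k hij (∈-congˡ (⋆-same i) hk)

      condA : ∀ i → i ≢ zero → T i i ≡ true → T zero zero ≡ true → CondA T
      condA i i≢0 hii h00 = i , i≢0 , λ a b → mk⇔ (members a b) (contains a b)
        where
        axis-end : ∀ b → T zero b ≡ true → b ≡ zero ⊎ b ≡ i
        axis-end b h with b ≟ zero
        ... | yes b≡0 = inj₁ b≡0
        ... | no b≢0  = inj₂ (sym (diagonal-axis-unique i b i≢0 b≢0 hii h))

        members : ∀ a b → T a b ≡ true → InA i a b
        members a b h with ∉X D h
        members _ b h | axisˡ b with axis-end b h
        ... | inj₁ refl = inj₂ (inj₂ (inj₁ (refl , refl)))
        ... | inj₂ refl = inj₁ (inj₁ (refl , refl))
        members a _ h | axisʳ a with axis-end a (∈-sym h)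
        ... | inj₁ refl = inj₂ (inj₂ (inj₁ (refl , refl)))
        ... | inj₂ refl = inj₁ (inj₂ (refl , refl))
        members a _ h | diagonal a with axis-end a (diagonal⇒axis a h h00)
        ... | inj₁ refl = inj₂ (inj₂ (inj₁ (refl , refl)))
        ... | inj₂ refl = inj₂ (inj₁ (inj₁ (refl , refl)))

        contains : ∀ a b → InA i a b → T a b ≡ true
        contains _ _ (inj₁ p)        = ∈-SamePair p (diagonal⇒axis i hii h00)
        contains _ _ (inj₂ (inj₁ p)) = ∈-SamePair p hii
        contains _ _ (inj₂ (inj₂ p)) = ∈-SamePair p h00

      condC : T zero zero ≢ true → CondC T
      condC h00∉ a b h with ∉X D h
      ... | axisˡ b    = ⊥-elim (h00∉ (axis⇒origin b h))
      ... | axisʳ a    = ⊥-elim (h00∉ (axis⇒origin a (∈-sym h)))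
      ... | diagonal a = refl , λ { refl → h00∉ h }

      reducedNice⇒cond : CondA T ⊎ CondB T ⊎ CondC T
      reducedNice⇒cond with T zero zero Bool.≟ true
      ... | no h00∉ = inj₂ (inj₂ (condC h00∉))
      ... | yes h00 with any? (λ m → ¬? (m ≟ zero) ×-dec (T m m Bool.≟ true))
      ...   | yes (i , i≢0 , hii) = inj₁ (condA i i≢0 hii h00)
      ...   | no no-diagonal      = inj₂ (inj₁ (condB h00 λ m m≢0 hmm → no-diagonal (m , m≢0 , hmm)))

  condA⇒reducedNice : CondA T → ReducedNice T
  condA⇒reducedNice (i , i≢0 , T≡A) = record
    { axis⇒origin          = λ _ _ → from zero zero (inj₂ (inj₂ (inj₁ (refl , refl))))
    ; diagonal⇒axis        = diagonal⇒axis
    ; diagonal-axis-unique = λ m n m≢0 n≢0 hmm h0n →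
        trans (nonzero-end m≢0 hmm) (sym (nonzero-end n≢0 (∈-sym h0n)))
    }
    where
    from : ∀ a b → InA i a b → T a b ≡ true
    from a b = Equivalence.from (T≡A a b)

    nonzero-end : ∀ {a b} → a ≢ zero → T a b ≡ true → a ≡ i
    nonzero-end {a} {b} a≢0 h with Equivalence.to (T≡A a b) h
    ... | inj₁ (inj₁ (a≡0 , _))        = ⊥-elim (a≢0 a≡0)
    ... | inj₁ (inj₂ (a≡i , _))        = a≡i
    ... | inj₂ (inj₁ (inj₁ (a≡i , _))) = a≡i
    ... | inj₂ (inj₁ (inj₂ (a≡i , _))) = a≡i
    ... | inj₂ (inj₂ (inj₁ (a≡0 , _))) = ⊥-elim (a≢0 a≡0)
    ... | inj₂ (inj₂ (inj₂ (a≡0 , _))) = ⊥-elim (a≢0 a≡0)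

    diagonal⇒axis : ∀ m → T m m ≡ true → T zero zero ≡ true → T zero m ≡ true
    diagonal⇒axis m hmm h00 with m ≟ zero
    ... | yes refl = h00
    ... | no m≢0 with nonzero-end m≢0 hmm
    ...   | refl = from zero m (inj₁ (inj₁ (refl , refl)))

  condB⇒reducedNice : CondB T → ReducedNice T
  condB⇒reducedNice (h00 , T⊆X_F) = record
    { axis⇒origin          = λ _ _ → h00
    ; diagonal⇒axis        = λ _ hmm _ → subst (λ x → T zero x ≡ true) (sym (diagonal-origin hmm)) h00
    ; diagonal-axis-unique = λ m _ m≢0 _ hmm _ → ⊥-elim (m≢0 (diagonal-origin hmm))
    }
    where
    diagonal-origin : ∀ {m} → T m m ≡ true → m ≡ zero
    diagonal-origin {m} hmm = reduce (T⊆X_F m m hmm)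

  condC⇒reducedNice : CondC T → ReducedNice T
  condC⇒reducedNice T⊆diagonal = record
    { axis⇒origin          = λ _ h0m → ⊥-elim (no-axis h0m)
    ; diagonal⇒axis        = λ _ _ h00 → ⊥-elim (no-axis h00)
    ; diagonal-axis-unique = λ _ _ _ _ _ h0n → ⊥-elim (no-axis h0n)
    }
    where
    no-axis : ∀ {m} → T zero m ≢ true
    no-axis {m} h0m = proj₂ (T⊆diagonal zero m h0m) refl

  cond⇒reducedNice : CondA T ⊎ CondB T ⊎ CondC T → ReducedNice T
  cond⇒reducedNice (inj₁ a)        = condA⇒reducedNice a
  cond⇒reducedNice (inj₂ (inj₁ b)) = condB⇒reducedNice b
  cond⇒reducedNice (inj₂ (inj₂ c)) = condC⇒reducedNice c

proposition4p2 : (T : Rel₀) → Symmetric T →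
    ((GenNice T → DisjointX T → CondA T ⊎ CondB T ⊎ CondC T) ×
     (DisjointX T → CondA T ⊎ CondB T ⊎ CondC T → GenNice T))
proposition4p2 T S =
  (λ nice D → reducedNice⇒cond S D (genNice⇒reducedNice S D nice)) ,
  (λ D cond → reducedNice⇒genNice S D (cond⇒reducedNice S cond))
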